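{- Let $G=([m]\cup[n]',E)$ be a monotone graph in its monotone labelling. Then $G$ is Hamiltonian if and only if it contains the ladder as a spanning subgraph, i.e., $m=n\ge2$ and every edge of $L_n$ is an edge of $G$.
   Context: $[m]=\{1,\dots,m\}$ and $[n]'=\{1',\dots,n'\}$. The monotone labelling means that every $\mathcal N(i)$, $i\in[m]$, is an interval $[\alpha'_i,\beta'_i]$ of consecutive elements of $[n]'$, with $\alpha'_i\le\alpha'_j$ and $\beta'_i\le\beta'_j$ whenever $i<j$; there are no isolated vertices. For $n\ge2$ the ladder $L_n$ is the graph on $[n]\cup[n]'$ with edges $(i,j')$ for $|i-j|\le1$. Hamiltonian means having a cycle through all vertices. -}

module Defs where

open import Data.Nat using (ℕ; zero; suc; _+_; _≤_)
open import Data.Fin using (Fin; toℕ; inject₁; fromℕ) renaming (zero to fzero; suc to fsuc)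
open import Data.Sum using (_⊎_; inj₁; inj₂)
open import Data.Product using (Σ; ∃; _×_; _,_)
open import Data.Empty using (⊥)
open import Function.Bundles using (_↔_; Inverse)
open import Relation.Binary.PropositionalEquality using (_≡_)

-- A monotone graph in its monotone labelling, with vertex set [m] ∪ [n]'
-- (left vertex i ↦ Fin m index i-1, right vertex j' ↦ Fin n index j-1).
-- N(i) = [α i , β i] (inclusive interval of right vertices).
record MonotoneGraph (m n : ℕ) : Set where
  field
    α β        : Fin m → Fin n
    nonempty   : ∀ i → toℕ (α i) ≤ toℕ (β i)
    α-mono     : ∀ i j → toℕ i ≤ toℕ j → toℕ (α i) ≤ toℕ (α j)
    β-mono     : ∀ i j → toℕ i ≤ toℕ j → toℕ (β i) ≤ toℕ (β j)
    covered    : ∀ (j : Fin n) → ∃ λ (i : Fin m) →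
                   toℕ (α i) ≤ toℕ j × toℕ j ≤ toℕ (β i)

open MonotoneGraph public

Edge : ∀ {m n} → MonotoneGraph m n → Fin m → Fin n → Set
Edge G i j = toℕ (α G i) ≤ toℕ j × toℕ j ≤ toℕ (β G i)

Vertex : ℕ → ℕ → Set
Vertex m n = Fin m ⊎ Fin n

Adj : ∀ {m n} → MonotoneGraph m n → Vertex m n → Vertex m n → Set
Adj G (inj₁ i) (inj₂ j) = Edge G i j
Adj G (inj₂ j) (inj₁ i) = Edge G i j
Adj G (inj₁ _) (inj₁ _) = ⊥
Adj G (inj₂ _) (inj₂ _) = ⊥

-- A Hamiltonian cycle: a cyclic enumeration c 0, c 1, …, c (k-1) of all
-- vertices, each exactly once (c is a bijection Fin k ↔ V), with k ≥ 3,
-- consecutive vertices adjacent and c (k-1) adjacent to c 0.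
Hamiltonian : ∀ {m n} → MonotoneGraph m n → Set
Hamiltonian {m} {n} G =
  Σ ℕ λ k → Σ (Fin (suc (suc (suc k))) ↔ Vertex m n) λ c →
    let f = Inverse.to c in
    (∀ (i : Fin (suc (suc k))) → Adj G (f (inject₁ i)) (f (fsuc i)))
    × Adj G (f (fromℕ (suc (suc k)))) (f fzero)

ContainsLadder : ∀ {m n} → MonotoneGraph m n → Set
ContainsLadder {m} {n} G =
  m ≡ n × 2 ≤ n ×
  (∀ (i : Fin m) (j : Fin n) → toℕ i ≤ suc (toℕ j) → toℕ j ≤ suc (toℕ i) → Edge G i j)

-- A Hamiltonian cycle alternates between the sides [m] and [n]', so m = n.  Call a set S of
-- indices closed if every left vertex of S has all its neighbours among the right vertices of S.
-- The right vertices preceding the left vertices of S on the cycle are |S| distinct members of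
-- the right copy of S, hence all of it, so the cycle never passes from S to a left vertex outside
-- S: a nonempty closed S is everything.  If β(i) ≤ i then {1,…,i} is closed, and if α(i) ≥ i then
-- {i,…,n} is closed; so β(i) > i for i < n and α(i) < i for i > 1, which together with
-- monotonicity and the absence of isolated vertices gives all edges of the ladder.
-- Conversely the ladder is traversed by a hairpin, up one rail and down the other.

module Submission where

open import Defs
open import Data.Bool using (Bool; true; false; not)
open import Data.Bool.Properties using (not-involutive)
open import Data.Fin using (Fin; toℕ; inject₁; fromℕ; fromℕ<; splitAt; join; opposite)
  renaming (zero to fzero; suc to fsuc)
open import Data.Fin.Induction using (<-weakInduction; <-weakInduction-startingFrom)
open import Data.Fin.Permutation using (↔⇒≡)
open import Data.Fin.Properties
  using (any?; injective⇒≤; cantor-schröder-bernstein; inject₁-injective; fromℕ≢inject₁; ≤fromℕ;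
         toℕ<n; toℕ-fromℕ; toℕ-fromℕ<; toℕ-inject₁; toℕ-↑ˡ; toℕ-↑ʳ; opposite-prop;
         opposite-involutive; splitAt-join; join-splitAt; +↔⊎)
  renaming (_≟_ to _≟ᶠ_)
open import Data.Nat using (ℕ; zero; suc; _+_; _∸_; _≤_; _<_; z≤n; s≤s; z<s; _<?_; _≤?_)
open import Data.Nat.Properties
open import Data.Product using (∃; _×_; _,_; proj₁; proj₂; swap)
open import Data.Sum using (_⊎_; inj₁; inj₂; [_,_]′; map₂; reduce)
open import Data.Sum.Properties using (inj₁-injective; inj₂-injective)
open import Function using (_∘_)
open import Function.Bundles using (_⇔_; _↔_; Inverse; Injection; mk⇔; mk↔ₛ′)
open import Function.Definitions using (Injective)
open import Function.Properties.Inverse using (↔-trans; ↔-sym; Inverse⇒Injection)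
open import Relation.Binary.PropositionalEquality using (_≡_; refl; sym; trans; cong; subst; module ≡-Reasoning)
open import Relation.Nullary using (yes; no; contradiction)
open import Relation.Unary using (Decidable)

injective⇒surjective : ∀ {n} {f : Fin n → Fin n} → Injective _≡_ _≡_ f → ∀ y → ∃ λ x → f x ≡ y
injective⇒surjective {n} {f} f-injective y with any? (λ x → f x ≟ᶠ y)
... | yes hit = hit
... | no miss = contradiction (injective⇒≤ extend-injective) 1+n≰n
  where
  extend : Fin (suc n) → Fin n
  extend fzero    = y
  extend (fsuc x) = f x

  extend-injective : Injective _≡_ _≡_ extend
  extend-injective {fzero}  {fzero}  _ = refl
  extend-injective {fzero}  {fsuc x} e = contradiction (x , sym e) miss
  extend-injective {fsuc x} {fzero}  e = contradiction (x , e) miss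
  extend-injective {fsuc x} {fsuc y} e = cong fsuc (f-injective e)

opposite-suc-pred : ∀ {n} {a b : Fin n} → suc (toℕ a) ≡ toℕ b → toℕ (opposite a) ≡ suc (toℕ (opposite b))
opposite-suc-pred {n} {a} {b} e = begin
  toℕ (opposite a)        ≡⟨ opposite-prop a ⟩
  n ∸ suc (toℕ a)         ≡⟨ cong (n ∸_) e ⟩
  suc n ∸ suc (toℕ b)     ≡⟨ +-∸-assoc 1 (toℕ<n b) ⟩
  suc (n ∸ suc (toℕ b))   ≡⟨ cong suc (opposite-prop b) ⟨
  suc (toℕ (opposite b))  ∎
  where open ≡-Reasoning

previous : ∀ {K} → Fin (suc K) → Fin (suc K)
previous {K} fzero = fromℕ K
previous (fsuc i)  = inject₁ i

previous-injective : ∀ {K} → Injective _≡_ _≡_ (previous {K})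
previous-injective {x = fzero}  {fzero}  _ = refl
previous-injective {x = fzero}  {fsuc j} e = contradiction e fromℕ≢inject₁
previous-injective {x = fsuc i} {fzero}  e = contradiction (sym e) fromℕ≢inject₁
previous-injective {x = fsuc i} {fsuc j} e = cong fsuc (inject₁-injective e)

previous-closed⇒all : ∀ {K} (Q : Fin (suc K) → Set) → (∀ q → Q (previous q) → Q q) →
                      ∀ {p} → Q p → ∀ q → Q q
previous-closed⇒all {K} Q closed {p} Qp = <-weakInduction Q (closed fzero Q-last) (closed ∘ fsuc)
  where
  Q-last : Q (fromℕ K)
  Q-last = <-weakInduction-startingFrom Q Qp (closed ∘ fsuc) (≤fromℕ p)

module _ {m n} (G : MonotoneGraph m n) where

  neighbour-of-left : ∀ {v j} → Adj G v (inj₁ j) → ∃ λ r → v ≡ inj₂ r × Edge G j r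
  neighbour-of-left {inj₂ r} e = r , refl , e

  neighbour-of-right : ∀ {v j} → Adj G v (inj₂ j) → ∃ λ l → v ≡ inj₁ l × Edge G l j
  neighbour-of-right {inj₁ l} e = l , refl , e

ladder-α : ∀ {m n} (G : MonotoneGraph m n) → (∀ i → 0 < toℕ i → toℕ (α G i) < toℕ i) →
           ∀ i (j : Fin n) → toℕ i ≤ suc (toℕ j) → toℕ (α G i) ≤ toℕ j
ladder-α G α-below fzero j _ with covered G j
... | i , αi≤j , _ = ≤-trans (α-mono G fzero i z≤n) αi≤j
ladder-α G α-below (fsuc i) j i<j+1 = ≤-pred (≤-trans (α-below (fsuc i) z<s) i<j+1)

ladder-β : ∀ {m n} (G : MonotoneGraph m n) → (∀ i → suc (toℕ i) < m → toℕ i < toℕ (β G i)) →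
           ∀ i j → toℕ j ≤ suc (toℕ i) → toℕ j ≤ toℕ (β G i)
ladder-β {m} G β-above i j j≤i+1 with suc (toℕ i) <? m | covered G j
... | yes i+1<m | _              = ≤-trans j≤i+1 (β-above i i+1<m)
... | no  i+1≮m | i′ , _ , j≤βi′ =
  ≤-trans j≤βi′ (β-mono G i′ i (≤-pred (≤-trans (toℕ<n i′) (≮⇒≥ i+1≮m))))

module HamiltonianCycle {m n} {G : MonotoneGraph m n} (H : Hamiltonian G) where

  private
    k = proj₁ H
    c = proj₁ (proj₂ H)

    open Inverse c using (to; from; strictlyInverseˡ; strictlyInverseʳ)

    previous-adj : ∀ q → Adj G (to (previous q)) (to q)
    previous-adj fzero    = proj₂ (proj₂ (proj₂ H))
    previous-adj (fsuc i) = proj₁ (proj₂ (proj₂ H)) i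

  cycle-length : suc (suc (suc k)) ≡ m + n
  cycle-length = ↔⇒≡ (↔-trans c (↔-sym +↔⊎))

  before : Vertex m n → Vertex m n
  before v = to (previous (from v))

  before-adj : ∀ v → Adj G (before v) v
  before-adj v = subst (Adj G (before v)) (strictlyInverseˡ v) (previous-adj (from v))

  before-injective : Injective _≡_ _≡_ before
  before-injective = Injection.injective (Inverse⇒Injection (↔-sym c))
                   ∘ previous-injective
                   ∘ Injection.injective (Inverse⇒Injection c)

  before-closed⇒all : (P : Vertex m n → Set) → (∀ v → P (before v) → P v) →
                      ∀ {u} → P u → ∀ v → P v
  before-closed⇒all P closed {u} Pu v =
    subst P (strictlyInverseˡ v)
      (previous-closed⇒all (P ∘ to) closed-on-positions (subst P (sym (strictlyInverseˡ u)) Pu) (from v))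
    where
    closed-on-positions : ∀ q → P (to (previous q)) → P (to q)
    closed-on-positions q P-prev =
      closed (to q) (subst (λ p → P (to (previous p))) (sym (strictlyInverseʳ q)) P-prev)

  before-left : Fin m → Fin n
  before-left l = proj₁ (neighbour-of-left G (before-adj (inj₁ l)))

  before-left-spec : ∀ l → before (inj₁ l) ≡ inj₂ (before-left l)
  before-left-spec l = proj₁ (proj₂ (neighbour-of-left G (before-adj (inj₁ l))))

  before-left-edge : ∀ l → Edge G l (before-left l)
  before-left-edge l = proj₂ (proj₂ (neighbour-of-left G (before-adj (inj₁ l))))

  before-right : Fin n → Fin m
  before-right j = proj₁ (neighbour-of-right G (before-adj (inj₂ j)))

  before-right-spec : ∀ j → before (inj₂ j) ≡ inj₁ (before-right j)
  before-right-spec j = proj₁ (proj₂ (neighbour-of-right G (before-adj (inj₂ j))))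

  before-right-edge : ∀ j → Edge G (before-right j) j
  before-right-edge j = proj₂ (proj₂ (neighbour-of-right G (before-adj (inj₂ j))))

  before-left-injective : Injective _≡_ _≡_ before-left
  before-left-injective {l} {l′} e = inj₁-injective (before-injective
    (trans (before-left-spec l) (trans (cong inj₂ e) (sym (before-left-spec l′)))))

  before-right-injective : Injective _≡_ _≡_ before-right
  before-right-injective {j} {j′} e = inj₂-injective (before-injective
    (trans (before-right-spec j) (trans (cong inj₁ e) (sym (before-right-spec j′)))))

  sides-balanced : m ≡ n
  sides-balanced = cantor-schröder-bernstein before-left-injective before-right-injective

3≤n+n⇒2≤n : ∀ n → 3 ≤ n + n → 2 ≤ n
3≤n+n⇒2≤n (suc zero)    (s≤s (s≤s ()))
3≤n+n⇒2≤n (suc (suc n)) _ = s≤s (s≤s z≤n)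

module BalancedHamiltonianCycle {n} {G : MonotoneGraph n n} (H : Hamiltonian G) where

  open HamiltonianCycle H

  2≤n : 2 ≤ n
  2≤n = 3≤n+n⇒2≤n n (subst (3 ≤_) cycle-length (s≤s (s≤s (s≤s z≤n))))

  module _ (S : Fin n → Set) (S? : Decidable S) (closed : ∀ {s j} → S s → Edge G s j → S j) where

    private
      shift : Fin n → Fin n
      shift j with S? j
      ... | yes _ = before-left j
      ... | no  _ = j

      shift-injective : Injective _≡_ _≡_ shift
      shift-injective {i} {j} e with S? i | S? j
      ... | yes _  | yes _  = before-left-injective e
      ... | yes Si | no ¬Sj = contradiction (subst S e (closed Si (before-left-edge i))) ¬Sj
      ... | no ¬Si | yes Sj = contradiction (subst S (sym e) (closed Sj (before-left-edge j))) ¬Si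
      ... | no  _  | no  _  = e

      entering : ∀ l → S (before-left l) → S l
      entering l S-before with injective⇒surjective shift-injective (before-left l)
      ... | x , hit with S? x
      ...   | yes Sx = subst S (before-left-injective hit) Sx
      ...   | no ¬Sx = contradiction (subst S (sym hit) S-before) ¬Sx

    neighbourhood-closed⇒all : ∀ {i} → S i → ∀ s → S s
    neighbourhood-closed⇒all Si s = before-closed⇒all P P-closed {inj₁ _} Si (inj₁ s)
      where
      P : Vertex n n → Set
      P = [ S , S ]′

      P-closed : ∀ v → P (before v) → P v
      P-closed (inj₁ l) P-before = entering l (subst P (before-left-spec l) P-before)
      P-closed (inj₂ j) P-before = closed (subst P (before-right-spec j) P-before) (before-right-edge j)

  β-above : ∀ i → suc (toℕ i) < n → toℕ i < toℕ (β G i)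
  β-above i i+1<n with toℕ i <? toℕ (β G i)
  ... | yes i<βi = i<βi
  ... | no  i≮βi = contradiction (subst (_≤ toℕ i) (toℕ-fromℕ< i+1<n) (all (fromℕ< i+1<n))) 1+n≰n
    where
    closed : ∀ {s j} → toℕ s ≤ toℕ i → Edge G s j → toℕ j ≤ toℕ i
    closed s≤i (_ , j≤βs) = ≤-trans j≤βs (≤-trans (β-mono G _ i s≤i) (≮⇒≥ i≮βi))

    all : ∀ s → toℕ s ≤ toℕ i
    all = neighbourhood-closed⇒all (λ s → toℕ s ≤ toℕ i) (λ s → toℕ s ≤? toℕ i) closed {i} ≤-refl

  α-below : ∀ i → 0 < toℕ i → toℕ (α G i) < toℕ i
  α-below i 0<i with toℕ (α G i) <? toℕ i
  ... | yes αi<i = αi<i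
  ... | no  αi≮i = contradiction (subst (toℕ i ≤_) (toℕ-fromℕ< 0<n) (all (fromℕ< 0<n))) (<⇒≱ 0<i)
    where
    0<n : 0 < n
    0<n = <-trans 0<i (toℕ<n i)

    closed : ∀ {s j} → toℕ i ≤ toℕ s → Edge G s j → toℕ i ≤ toℕ j
    closed i≤s (αs≤j , _) = ≤-trans (≮⇒≥ αi≮i) (≤-trans (α-mono G i _ i≤s) αs≤j)

    all : ∀ s → toℕ i ≤ toℕ s
    all = neighbourhood-closed⇒all (λ s → toℕ i ≤ toℕ s) (λ s → toℕ i ≤? toℕ s) closed {i} ≤-refl

hamiltonian⇒ladder : ∀ {m n} (G : MonotoneGraph m n) → Hamiltonian G → ContainsLadder G
hamiltonian⇒ladder G H with HamiltonianCycle.sides-balanced H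
... | refl = refl , 2≤n , λ i j i≤j+1 j≤i+1 →
  ladder-α G α-below i j i≤j+1 , ladder-β G β-above i j j≤i+1
  where open BalancedHamiltonianCycle H

previous-adj⇒hamiltonian : ∀ {m n} (G : MonotoneGraph m n) {K} → 2 ≤ K → (c : Fin (suc K) ↔ Vertex m n) →
                           (∀ q → Adj G (Inverse.to c (previous q)) (Inverse.to c q)) → Hamiltonian G
previous-adj⇒hamiltonian G {suc (suc k)} (s≤s (s≤s z≤n)) c adj = k , c , adj ∘ fsuc , adj fzero

even : ℕ → Bool
even zero    = true
even (suc t) = not (even t)

side : ∀ {A : Set} → Bool → A → A ⊎ A
side true  = inj₁
side false = inj₂

module _ {n : ℕ} where

  parity : Fin n ⊎ Fin n → Bool
  parity (inj₁ a) = even (toℕ a)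
  parity (inj₂ b) = not (even (toℕ b))

  row : Fin n ⊎ Fin n → Fin n
  row = reduce

  -- A walk along a rail alternates sides: position r of a rail is vertex r on one side for even r
  -- and on the other side for odd r (the two rails starting on opposite sides).
  zigzag : Fin n ⊎ Fin n → Vertex n n
  zigzag x = side (parity x) (row x)

  zigzag-involutive : ∀ x → zigzag (zigzag x) ≡ x
  zigzag-involutive (inj₁ a) with even (toℕ a) in e
  ... | true  rewrite e = refl
  ... | false rewrite e = refl
  zigzag-involutive (inj₂ b) with even (toℕ b) in e
  ... | true  rewrite e = refl
  ... | false rewrite e = refl

  HairpinStep : Fin n ⊎ Fin n → Fin n ⊎ Fin n → Set
  HairpinStep (inj₁ a) (inj₁ b) = suc (toℕ a) ≡ toℕ b
  HairpinStep (inj₁ a) (inj₂ b) = toℕ a ≡ toℕ b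
  HairpinStep (inj₂ a) (inj₂ b) = toℕ a ≡ suc (toℕ b)
  HairpinStep (inj₂ a) (inj₁ b) = toℕ a ≡ toℕ b

  hairpin-step-parity : ∀ x y → HairpinStep x y → parity y ≡ not (parity x)
  hairpin-step-parity (inj₁ a) (inj₁ b) e = cong even (sym e)
  hairpin-step-parity (inj₁ a) (inj₂ b) e = cong (not ∘ even) (sym e)
  hairpin-step-parity (inj₂ a) (inj₂ b) e = sym (trans (not-involutive _) (cong even e))
  hairpin-step-parity (inj₂ a) (inj₁ b) e = sym (trans (not-involutive _) (cong even e))

  Near : Fin n → Fin n → Set
  Near a b = toℕ a ≤ suc (toℕ b) × toℕ b ≤ suc (toℕ a)

  near-suc : ∀ {a b} → suc (toℕ a) ≡ toℕ b → Near a b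
  near-suc e = m≤n⇒m≤1+n (≤-trans (n≤1+n _) (≤-reflexive e)) , ≤-reflexive (sym e)

  near-≡ : ∀ {a b} → toℕ a ≡ toℕ b → Near a b
  near-≡ e = m≤n⇒m≤1+n (≤-reflexive e) , m≤n⇒m≤1+n (≤-reflexive (sym e))

  hairpin-step-near : ∀ x y → HairpinStep x y → Near (row x) (row y)
  hairpin-step-near (inj₁ a) (inj₁ b) e = near-suc e
  hairpin-step-near (inj₁ a) (inj₂ b) e = near-≡ e
  hairpin-step-near (inj₂ a) (inj₂ b) e = swap (near-suc (sym e))
  hairpin-step-near (inj₂ a) (inj₁ b) e = near-≡ e

module LadderCycle {n₁} (G : MonotoneGraph (suc n₁) (suc n₁))
  (rung : ∀ i j → toℕ i ≤ suc (toℕ j) → toℕ j ≤ suc (toℕ i) → Edge G i j) where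

  private
    n : ℕ
    n = suc n₁

  zigzag-adj : ∀ x y → HairpinStep x y → Adj G (zigzag x) (zigzag y)
  zigzag-adj x y step =
    subst (λ b → Adj G (zigzag x) (side b (row y))) (sym (hairpin-step-parity x y step))
      (opposite-sides (parity x) (hairpin-step-near x y step))
    where
    opposite-sides : ∀ b {a c} → Near a c → Adj G (side b a) (side (not b) c)
    opposite-sides true  (a≤c+1 , c≤a+1) = rung _ _ a≤c+1 c≤a+1
    opposite-sides false (a≤c+1 , c≤a+1) = rung _ _ c≤a+1 a≤c+1

  reflect : Fin n ⊎ Fin n → Fin n ⊎ Fin n
  reflect = map₂ opposite

  reflect-involutive : ∀ x → reflect (reflect x) ≡ x
  reflect-involutive (inj₁ a) = refl
  reflect-involutive (inj₂ b) = cong inj₂ (opposite-involutive b)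

  -- The rails are the two copies of Fin n: positions 0 … n-1 run up the first rail,
  -- positions n … 2n-1 run down the second.
  hairpin : Fin (n + n) ↔ (Fin n ⊎ Fin n)
  hairpin = mk↔ₛ′ (reflect ∘ splitAt n) (join n n ∘ reflect)
    (λ x → trans (cong reflect (splitAt-join n n (reflect x))) (reflect-involutive x))
    (λ p → trans (cong (join n n) (reflect-involutive (splitAt n p))) (join-splitAt n n p))

  index : Fin n ⊎ Fin n → ℕ
  index (inj₁ a) = toℕ a
  index (inj₂ b) = n + toℕ b

  index-splitAt : ∀ p → index (splitAt n p) ≡ toℕ p
  index-splitAt p = trans (index-join (splitAt n p)) (cong toℕ (join-splitAt n n p))
    where
    index-join : ∀ x → index x ≡ toℕ (join n n x)
    index-join (inj₁ a) = sym (toℕ-↑ˡ a n)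
    index-join (inj₂ b) = sym (toℕ-↑ʳ n b)

  consecutive : ∀ x y → suc (index x) ≡ index y → HairpinStep (reflect x) (reflect y)
  consecutive (inj₁ a) (inj₁ b) e = e
  consecutive (inj₁ a) (inj₂ fzero) e =
    trans (suc-injective e) (trans (+-identityʳ n₁) (sym (toℕ-fromℕ n₁)))
  consecutive (inj₁ a) (inj₂ (fsuc b)) e =
    contradiction (subst (_≤ n) e (toℕ<n a)) (m+1+n≰m n)
  consecutive (inj₂ a) (inj₁ b) e =
    contradiction (<⇒≤ (subst (_< n) (sym e) (toℕ<n b))) (m+n≮m n (toℕ a))
  consecutive (inj₂ a) (inj₂ b) e =
    opposite-suc-pred (+-cancelˡ-≡ n _ _ (trans (+-suc n (toℕ a)) e))

  wraps : ∀ x → index x ≡ n₁ + n → HairpinStep (reflect x) (inj₁ fzero)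
  wraps (inj₁ a) e = contradiction (≤-trans (m≤n+m n n₁) (≤-reflexive (sym e))) (<⇒≱ (toℕ<n a))
  wraps (inj₂ b) e = begin
    toℕ (opposite b)  ≡⟨ opposite-prop b ⟩
    n ∸ suc (toℕ b)   ≡⟨ cong (λ t → n ∸ suc t) (+-cancelˡ-≡ n _ _ (trans e (+-comm n₁ n))) ⟩
    n ∸ n             ≡⟨ n∸n≡0 n ⟩
    0                 ∎
    where open ≡-Reasoning

  hairpin-step : ∀ q → HairpinStep (Inverse.to hairpin (previous q)) (Inverse.to hairpin q)
  hairpin-step fzero    = wraps (splitAt n (fromℕ (n₁ + n))) (trans (index-splitAt _) (toℕ-fromℕ _))
  hairpin-step (fsuc i) = consecutive (splitAt n (inject₁ i)) (splitAt n (fsuc i)) (begin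
    suc (index (splitAt n (inject₁ i)))  ≡⟨ cong suc (index-splitAt (inject₁ i)) ⟩
    suc (toℕ (inject₁ i))                ≡⟨ cong suc (toℕ-inject₁ i) ⟩
    toℕ (fsuc i)                         ≡⟨ index-splitAt (fsuc i) ⟨
    index (splitAt n (fsuc i))           ∎)
    where open ≡-Reasoning

  ladder-cycle : Fin (n + n) ↔ Vertex n n
  ladder-cycle = ↔-trans hairpin (mk↔ₛ′ zigzag zigzag zigzag-involutive zigzag-involutive)

  ladder-cycle-adj : ∀ q → Adj G (Inverse.to ladder-cycle (previous q)) (Inverse.to ladder-cycle q)
  ladder-cycle-adj q = zigzag-adj _ _ (hairpin-step q)

ladder⇒hamiltonian : ∀ {m n} (G : MonotoneGraph m n) → ContainsLadder G → Hamiltonian G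
ladder⇒hamiltonian G (refl , s≤s (s≤s {n = n₂} z≤n) , rung) =
  previous-adj⇒hamiltonian G (≤-trans (s≤s (s≤s z≤n)) (m≤n+m (suc (suc n₂)) (suc n₂)))
    ladder-cycle ladder-cycle-adj
  where open LadderCycle {suc n₂} G rung

lemma14 : (m n : ℕ) → (G : MonotoneGraph m n) →
    Hamiltonian G ⇔ ContainsLadder G
lemma14 m n G = mk⇔ (hamiltonian⇒ladder G) (ladder⇒hamiltonian G)
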